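{- Let $Q$ be a quiver with normal vertices $v_1,\dots,v_n$ and no starred vertices, and let $Q_\star$ be the starred quiver obtained from $Q$ by replacing the vertex $v_1$ with a starred vertex $\star$ (so $Q_\star$ has normal vertices $v_2,\dots,v_n$). Then $\mathrm{Root}(Q)\subset\mathbb R^n$ is integrally equivalent to $\mathrm{Root}(Q_\star)\subset\mathbb R^{n-1}$.
   Context: A quiver $Q$ has normal vertices $\mathcal V_\bullet=\{v_1,\dots,v_n\}$, a possibly empty set of starred vertices, and arrows each going normal-to-normal, normal-to-starred or starred-to-normal (never starred-to-starred); no loops, no repeated arrows, connected underlying graph. It is a starred quiver if it has at least one starred vertex. For each arrow $a$ define $u_a\in\mathbb R^{N}$, where $N$ is the number of normal vertices and the coordinates are indexed by the normal vertices: $u_a=e_j-e_i$ if $a:v_i\to v_j$; $u_a=e_j$ if $a:\star\to v_j$; $u_a=-e_i$ if $a:v_i\to\star$. The root polytope is $\mathrm{Root}(Q)=\mathrm{Conv}\{u_a\}$. Two lattice polytopes $\mathbf P_1\subset\mathbb R^n$, $\mathbf P_2\subset\mathbb R^m$ are integrally equivalent if there is an affine map restricting to a bijection $\mathbf P_1\to\mathbf P_2$ and to a bijection between $\mathbb Z^n\cap\mathrm{aff}(\mathbf P_1)$ and $\mathbb Z^m\cap\mathrm{aff}(\mathbf P_2)$.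
   Formalization: The root polytopes lie in ℚ^n and ℚ^(n−1) instead of ℝ^n and ℝ^(n−1), and integral equivalence uses an affine map with rational coefficients that is bijective on rational points of the polytopes. -}

module Defs where

open import Data.Nat using (ℕ; zero; suc)
open import Data.Fin using (Fin; zero; suc)
open import Data.Integer using (ℤ; +_)
open import Data.Rational using (ℚ; _/_; 0ℚ; 1ℚ; _+_; _*_; -_; _≤_)
open import Data.Vec using (Vec; []; _∷_; replicate; zipWith; map; foldr)
open import Data.List using (List; []; _∷_; length)
import Data.List as L
open import Data.List.Membership.Propositional using (_∈_)
open import Data.List.Relation.Unary.All using (All)
open import Data.List.Relation.Unary.Unique.Propositional using (Unique)
open import Data.Product using (Σ; _×_; _,_; ∃; proj₁; proj₂)
open import Data.Sum using (_⊎_; inj₁; inj₂)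
open import Relation.Binary.PropositionalEquality using (_≡_)
open import Relation.Nullary using (¬_)

Vecℚ : ℕ → Set
Vecℚ N = Vec ℚ N

0v : ∀ {N} → Vecℚ N
0v = replicate _ 0ℚ

_+v_ : ∀ {N} → Vecℚ N → Vecℚ N → Vecℚ N
_+v_ = zipWith _+_

_·v_ : ∀ {N} → ℚ → Vecℚ N → Vecℚ N
c ·v x = map (c *_) x

e : ∀ {N} → Fin N → Vecℚ N
e {suc N} zero    = 1ℚ ∷ 0v
e {suc N} (suc i) = 0ℚ ∷ e i

-v_ : ∀ {N} → Vecℚ N → Vecℚ N
-v x = map -_ x

lincomb : ∀ {N} → (ps : List (Vecℚ N)) → Vec ℚ (length ps) → Vecℚ N
lincomb []       []       = 0v
lincomb (p ∷ ps) (c ∷ cs) = (c ·v p) +v lincomb ps cs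

sumℚ : ∀ {k} → Vec ℚ k → ℚ
sumℚ = foldr _ _+_ 0ℚ

_∈Conv_ : ∀ {N} → Vecℚ N → List (Vecℚ N) → Set
x ∈Conv ps = Σ (Vec ℚ (length ps)) λ c →
  Data.Vec.Relation.Unary.All.All (0ℚ ≤_) c × sumℚ c ≡ 1ℚ × lincomb ps c ≡ x
  where import Data.Vec.Relation.Unary.All

_∈Aff_ : ∀ {N} → Vecℚ N → List (Vecℚ N) → Set
x ∈Aff ps = Σ (Vec ℚ (length ps)) λ c → sumℚ c ≡ 1ℚ × lincomb ps c ≡ x

IsLattice : ∀ {N} → Vecℚ N → Set
IsLattice {N} x = Σ (Vec ℤ N) λ z → map (λ k → k / 1) z ≡ x

record Affine (n m : ℕ) : Set where
  constructor affine
  field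
    A : Vec (Vecℚ n) m
    b : Vecℚ m

dot : ∀ {n} → Vecℚ n → Vecℚ n → ℚ
dot x y = sumℚ (zipWith _*_ x y)

apply : ∀ {n m} → Affine n m → Vecℚ n → Vecℚ m
apply (affine A b) x = map (λ row → dot row x) A +v b

RestrictsToBijection : ∀ {n m} → Affine n m → (Vecℚ n → Set) → (Vecℚ m → Set) → Set
RestrictsToBijection f S T =
  (∀ x → S x → T (apply f x)) ×
  (∀ x y → S x → S y → apply f x ≡ apply f y → x ≡ y) ×
  (∀ y → T y → Σ (Vecℚ _) λ x → S x × apply f x ≡ y)

IntegrallyEquivalent : ∀ {n m} → List (Vecℚ n) → List (Vecℚ m) → Set
IntegrallyEquivalent {n} {m} ps qs = Σ (Affine n m) λ f →
  RestrictsToBijection f (λ x → x ∈Conv ps) (λ y → y ∈Conv qs) ×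
  RestrictsToBijection f (λ x → IsLattice x × x ∈Aff ps) (λ y → IsLattice y × y ∈Aff qs)

-- Quivers.  Vertices are  Fin N ⊎ Fin S : inj₁ i = normal vertex, inj₂ s = starred.
-- An arrow is a (source , target) pair; the quiver is a list of arrows.

Vertex : ℕ → ℕ → Set
Vertex N S = Fin N ⊎ Fin S

Arrow : ℕ → ℕ → Set
Arrow N S = Vertex N S × Vertex N S

data Adj {N S} (Q : List (Arrow N S)) : Vertex N S → Vertex N S → Set where
  fwd : ∀ {x y} → (x , y) ∈ Q → Adj Q x y
  bwd : ∀ {x y} → (y , x) ∈ Q → Adj Q x y

data Reach {N S} (Q : List (Arrow N S)) : Vertex N S → Vertex N S → Set where
  here  : ∀ {x} → Reach Q x x
  step  : ∀ {x y z} → Adj Q x y → Reach Q y z → Reach Q x z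

NotStarStar : ∀ {N S} → Arrow N S → Set
NotStarStar (inj₂ _ , inj₂ _) = Data.Empty.⊥ where import Data.Empty
NotStarStar _                 = Data.Unit.⊤ where import Data.Unit

IsQuiver : ∀ {N S} → List (Arrow N S) → Set
IsQuiver {N} {S} Q =
  All (λ a → ¬ (proj₁ a ≡ proj₂ a)) Q ×
  Unique Q ×
  All NotStarStar Q ×
  (∀ x y → Reach Q x y)

u : ∀ {N S} → Arrow N S → Vecℚ N
u (inj₁ i , inj₁ j) = e j +v (-v e i)
u (inj₂ _ , inj₁ j) = e j
u (inj₁ i , inj₂ _) = -v e i
u (inj₂ _ , inj₂ _) = 0v   -- never occurs in a quiver (no starred-to-starred arrows)

-- Root(Q) = Conv{u_a}, given by its list of generating points
RootPts : ∀ {N S} → List (Arrow N S) → List (Vecℚ N)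
RootPts Q = L.map u Q

starV : ∀ {m} → Vertex (suc m) 0 → Vertex m 1
starV (inj₁ zero)    = inj₂ zero
starV (inj₁ (suc i)) = inj₁ i
starV (inj₂ ())

starQ : ∀ {m} → List (Arrow (suc m) 0) → List (Arrow m 1)
starQ = L.map (λ a → starV (proj₁ a) , starV (proj₂ a))

module Submission where

open import Defs
open import Data.Nat using (ℕ; suc; zero)
open import Data.List using (List; []; _∷_; length)
open import Data.List.Relation.Unary.All using (All; []; _∷_)
import Data.List.Relation.Unary.All as All
import Data.List.Relation.Unary.All.Properties as All
open import Data.List.Relation.Binary.Pointwise using (Pointwise; []; _∷_)
import Data.List.Relation.Binary.Pointwise as Pointwise
open import Data.Fin using (Fin; zero; suc)
open import Data.Vec using (Vec; []; _∷_; tail; map; zipWith; tabulate; lookup)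
open import Data.Vec.Properties using (tabulate-∘; tabulate-cong; tabulate∘lookup)
import Data.Vec.Relation.Unary.All as Vec
open import Data.Rational using (ℚ; 0ℚ; 1ℚ; _+_; _*_; -_; _≤_; _/_; toℚᵘ)
open import Data.Rational.Properties
import Data.Rational.Unnormalised as ℚᵘ
import Data.Rational.Unnormalised.Properties as ℚᵘ
open import Data.Integer using (ℤ)
import Data.Integer as ℤ
import Data.Integer.Properties as ℤ
open import Data.Product using (Σ; _×_; _,_; proj₁; proj₂)
open import Data.Sum using (inj₁; inj₂)
open import Function using (flip)
open import Relation.Binary.PropositionalEquality

-- Every root u_a of a star-free quiver has coordinate sum 0, so Root(Q) and its affine
-- hull lie in the hyperplane x₁ + ⋯ + xₙ = 0.  Forgetting the first coordinate is an
-- isomorphism of that hyperplane onto ℚⁿ⁻¹ which preserves and reflects integrality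
-- (x₁ = -(x₂ + ⋯ + xₙ)), and it sends u_a to the root of the starred arrow.  So it maps
-- convex and affine combinations of Root(Q) to those of Root(Q⋆) with the same coefficients.

+v-identityˡ : ∀ {N} (x : Vecℚ N) → 0v +v x ≡ x
+v-identityˡ []      = refl
+v-identityˡ (a ∷ x) = cong₂ _∷_ (+-identityˡ a) (+v-identityˡ x)

+v-identityʳ : ∀ {N} (x : Vecℚ N) → x +v 0v ≡ x
+v-identityʳ []      = refl
+v-identityʳ (a ∷ x) = cong₂ _∷_ (+-identityʳ a) (+v-identityʳ x)

-v-0v : ∀ {N} → -v (0v {N}) ≡ 0v
-v-0v {zero}  = refl
-v-0v {suc N} = cong (0ℚ ∷_) (-v-0v {N})

tail-+v : ∀ {N} (x y : Vecℚ (suc N)) → tail (x +v y) ≡ tail x +v tail y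
tail-+v (a ∷ x) (b ∷ y) = refl

tail-·v : ∀ {N} c (x : Vecℚ (suc N)) → tail (c ·v x) ≡ c ·v tail x
tail-·v c (a ∷ x) = refl

sumℚ-+v : ∀ {N} (x y : Vecℚ N) → sumℚ (x +v y) ≡ sumℚ x + sumℚ y
sumℚ-+v []      []      = refl
sumℚ-+v (a ∷ x) (b ∷ y) = begin
  (a + b) + sumℚ (x +v y)     ≡⟨ cong ((a + b) +_) (sumℚ-+v x y) ⟩
  (a + b) + (sumℚ x + sumℚ y) ≡⟨ +-assoc a b _ ⟩
  a + (b + (sumℚ x + sumℚ y)) ≡⟨ cong (a +_) (sym (+-assoc b (sumℚ x) (sumℚ y))) ⟩
  a + ((b + sumℚ x) + sumℚ y) ≡⟨ cong (λ w → a + (w + sumℚ y)) (+-comm b (sumℚ x)) ⟩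
  a + ((sumℚ x + b) + sumℚ y) ≡⟨ cong (a +_) (+-assoc (sumℚ x) b (sumℚ y)) ⟩
  a + (sumℚ x + (b + sumℚ y)) ≡⟨ sym (+-assoc a (sumℚ x) _) ⟩
  (a + sumℚ x) + (b + sumℚ y) ∎
  where open ≡-Reasoning

sumℚ-·v : ∀ {N} c (x : Vecℚ N) → sumℚ (c ·v x) ≡ c * sumℚ x
sumℚ-·v c []      = sym (*-zeroʳ c)
sumℚ-·v c (a ∷ x) = trans (cong (c * a +_) (sumℚ-·v c x)) (sym (*-distribˡ-+ c a _))

sumℚ-negate : ∀ {N} (x : Vecℚ N) → sumℚ (-v x) ≡ - sumℚ x
sumℚ-negate []      = refl
sumℚ-negate (a ∷ x) = trans (cong (- a +_) (sumℚ-negate x)) (sym (neg-distrib-+ a _))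

sumℚ-0v : ∀ {N} → sumℚ (0v {N}) ≡ 0ℚ
sumℚ-0v {zero}  = refl
sumℚ-0v {suc N} = trans (+-identityˡ _) (sumℚ-0v {N})

sumℚ-e : ∀ {N} (j : Fin N) → sumℚ (e j) ≡ 1ℚ
sumℚ-e {suc N} zero    = trans (cong (1ℚ +_) (sumℚ-0v {N})) (+-identityʳ 1ℚ)
sumℚ-e {suc N} (suc j) = trans (+-identityˡ _) (sumℚ-e j)

dot-e : ∀ {N} (j : Fin N) (x : Vecℚ N) → dot (e j) x ≡ lookup x j
dot-e {suc N} zero (a ∷ x) = begin
  1ℚ * a + sumℚ (zipWith _*_ 0v x) ≡⟨ cong₂ _+_ (*-identityˡ a) (dot-0v x) ⟩
  a + 0ℚ                           ≡⟨ +-identityʳ a ⟩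
  a                                ∎
  where
  open ≡-Reasoning
  dot-0v : ∀ {K} (x : Vecℚ K) → sumℚ (zipWith _*_ 0v x) ≡ 0ℚ
  dot-0v []      = refl
  dot-0v (b ∷ x) = trans (cong₂ _+_ (*-zeroˡ b) (dot-0v x)) (+-identityˡ 0ℚ)
dot-e {suc N} (suc j) (a ∷ x) = trans (cong₂ _+_ (*-zeroˡ a) (dot-e j x)) (+-identityˡ _)

+≡0⇒≡- : ∀ a b → a + b ≡ 0ℚ → a ≡ - b
+≡0⇒≡- a b a+b≡0 = begin
  a              ≡⟨ sym (+-identityʳ a) ⟩
  a + 0ℚ         ≡⟨ cong (a +_) (sym (+-inverseʳ b)) ⟩
  a + (b + - b)  ≡⟨ sym (+-assoc a b _) ⟩
  (a + b) + - b  ≡⟨ cong (_+ - b) a+b≡0 ⟩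
  0ℚ + - b       ≡⟨ +-identityˡ _ ⟩
  - b            ∎
  where open ≡-Reasoning

sum≡0⇒head≡-sum-tail : ∀ {N} (x : Vecℚ (suc N)) → sumℚ x ≡ 0ℚ → x ≡ (- sumℚ (tail x)) ∷ tail x
sum≡0⇒head≡-sum-tail (a ∷ x) sum≡0 = cong (_∷ x) (+≡0⇒≡- a _ sum≡0)

tail-injective-on-sum≡0 : ∀ {N} (x y : Vecℚ (suc N)) → sumℚ x ≡ 0ℚ → sumℚ y ≡ 0ℚ →
  tail x ≡ tail y → x ≡ y
tail-injective-on-sum≡0 x y sx≡0 sy≡0 tx≡ty = begin
  x                          ≡⟨ sum≡0⇒head≡-sum-tail x sx≡0 ⟩
  (- sumℚ (tail x)) ∷ tail x ≡⟨ cong (λ t → (- sumℚ t) ∷ t) tx≡ty ⟩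
  (- sumℚ (tail y)) ∷ tail y ≡⟨ sym (sum≡0⇒head≡-sum-tail y sy≡0) ⟩
  y                          ∎
  where open ≡-Reasoning

IsInteger : ℚ → Set
IsInteger q = Σ ℤ λ k → k / 1 ≡ q

-- k / 1 is definitionally fromℚᵘ (mkℚᵘ k 0), so both identities are checked in ℚᵘ.
/1-homo-+ : ∀ a b → (a / 1) + (b / 1) ≡ (a ℤ.+ b) / 1
/1-homo-+ a b = toℚᵘ-injective (ℚᵘ.≃-trans (toℚᵘ-homo-+ (a / 1) (b / 1))
  (ℚᵘ.≃-trans (ℚᵘ.+-cong (toℚᵘ-fromℚᵘ (ℚᵘ.mkℚᵘ a 0)) (toℚᵘ-fromℚᵘ (ℚᵘ.mkℚᵘ b 0)))
  (ℚᵘ.≃-trans (ℚᵘ.≃-reflexive (cong (λ k → ℚᵘ.mkℚᵘ k 0) (cong₂ ℤ._+_ (ℤ.*-identityʳ a) (ℤ.*-identityʳ b))))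
  (ℚᵘ.≃-sym (toℚᵘ-fromℚᵘ (ℚᵘ.mkℚᵘ (a ℤ.+ b) 0))))))

/1-homo-‿- : ∀ a → - (a / 1) ≡ (ℤ.- a) / 1
/1-homo-‿- a = toℚᵘ-injective (ℚᵘ.≃-trans (toℚᵘ-homo‿- (a / 1))
  (ℚᵘ.≃-trans (ℚᵘ.-‿cong (toℚᵘ-fromℚᵘ (ℚᵘ.mkℚᵘ a 0)))
  (ℚᵘ.≃-sym (toℚᵘ-fromℚᵘ (ℚᵘ.mkℚᵘ (ℤ.- a) 0)))))

sumℚ-IsLattice : ∀ {N} (x : Vecℚ N) → IsLattice x → IsInteger (sumℚ x)
sumℚ-IsLattice []      ([] , refl)    = ℤ.+ 0 , refl
sumℚ-IsLattice (_ ∷ x) (a ∷ z , refl) with sumℚ-IsLattice x (z , refl)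
... | k , k≡sum = a ℤ.+ k , trans (sym (/1-homo-+ a k)) (cong ((a / 1) +_) k≡sum)

IsLattice-tail : ∀ {N} (x : Vecℚ (suc N)) → IsLattice x → IsLattice (tail x)
IsLattice-tail x (_ ∷ z , refl) = z , refl

sum≡0⇒IsLattice : ∀ {N} (x : Vecℚ (suc N)) → sumℚ x ≡ 0ℚ → IsLattice (tail x) → IsLattice x
sum≡0⇒IsLattice x sum≡0 (z , z≡tail) with sumℚ-IsLattice (tail x) (z , z≡tail)
... | k , k≡sum = ℤ.- k ∷ z , sym (trans (sum≡0⇒head≡-sum-tail x sum≡0)
  (cong₂ _∷_ (trans (cong -_ (sym k≡sum)) (/1-homo-‿- k)) (sym z≡tail)))

sumℚ-lincomb : ∀ {N} (ps : List (Vecℚ N)) c → All (λ p → sumℚ p ≡ 0ℚ) ps →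
  sumℚ (lincomb ps c) ≡ 0ℚ
sumℚ-lincomb {N} [] [] [] = sumℚ-0v {N}
sumℚ-lincomb (p ∷ ps) (c ∷ cs) (sp≡0 ∷ sps≡0) = begin
  sumℚ ((c ·v p) +v lincomb ps cs)       ≡⟨ sumℚ-+v (c ·v p) _ ⟩
  sumℚ (c ·v p) + sumℚ (lincomb ps cs)   ≡⟨ cong₂ _+_ (sumℚ-·v c p) (sumℚ-lincomb ps cs sps≡0) ⟩
  c * sumℚ p + 0ℚ                        ≡⟨ cong (λ s → c * s + 0ℚ) sp≡0 ⟩
  c * 0ℚ + 0ℚ                            ≡⟨ cong (_+ 0ℚ) (*-zeroʳ c) ⟩
  0ℚ + 0ℚ                                ≡⟨ +-identityˡ 0ℚ ⟩
  0ℚ                                     ∎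
  where open ≡-Reasoning

relabel : ∀ {A B : Set} {R : A → B → Set} {xs ys} →
  Pointwise R xs ys → Vec ℚ (length xs) → Vec ℚ (length ys)
relabel []       []       = []
relabel (_ ∷ rs) (c ∷ cs) = c ∷ relabel rs cs

sumℚ-relabel : ∀ {A B : Set} {R : A → B → Set} {xs ys} (rs : Pointwise R xs ys) c →
  sumℚ (relabel rs c) ≡ sumℚ c
sumℚ-relabel []       []       = refl
sumℚ-relabel (_ ∷ rs) (c ∷ cs) = cong (c +_) (sumℚ-relabel rs cs)

relabel-nonneg : ∀ {A B : Set} {R : A → B → Set} {xs ys} (rs : Pointwise R xs ys) c →
  Vec.All (0ℚ ≤_) c → Vec.All (0ℚ ≤_) (relabel rs c)
relabel-nonneg []       []       Vec.[]         = Vec.[]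
relabel-nonneg (_ ∷ rs) (c ∷ cs) (0≤c Vec.∷ al) = 0≤c Vec.∷ relabel-nonneg rs cs al

flip-Pointwise : ∀ {A B : Set} {R : A → B → Set} {xs ys} → Pointwise R xs ys → Pointwise (flip R) ys xs
flip-Pointwise = Pointwise.symmetric (λ r → r)

relabel-inverse : ∀ {A B : Set} {R : A → B → Set} {xs ys} (rs : Pointwise R xs ys) c →
  relabel rs (relabel (flip-Pointwise rs) c) ≡ c
relabel-inverse []       []       = refl
relabel-inverse (_ ∷ rs) (c ∷ cs) = cong (c ∷_) (relabel-inverse rs cs)

_TailsTo_ : ∀ {N} → List (Vecℚ (suc N)) → List (Vecℚ N) → Set
ps TailsTo qs = Pointwise (λ p q → tail p ≡ q) ps qs

tail-lincomb : ∀ {N} {ps : List (Vecℚ (suc N))} {qs} (rs : ps TailsTo qs) c →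
  tail (lincomb ps c) ≡ lincomb qs (relabel rs c)
tail-lincomb [] [] = refl
tail-lincomb {ps = p ∷ ps} {q ∷ qs} (tp≡q ∷ rs) (c ∷ cs) = begin
  tail ((c ·v p) +v lincomb ps cs)                ≡⟨ tail-+v (c ·v p) _ ⟩
  tail (c ·v p) +v tail (lincomb ps cs)           ≡⟨ cong₂ _+v_ (trans (tail-·v c p) (cong (c ·v_) tp≡q))
                                                                (tail-lincomb rs cs) ⟩
  (c ·v q) +v lincomb qs (relabel rs cs)          ∎
  where open ≡-Reasoning

dropHead : ∀ m → Affine (suc m) m
dropHead m = affine (tabulate (λ i → e (suc i))) 0v

apply-dropHead : ∀ {m} (x : Vecℚ (suc m)) → apply (dropHead m) x ≡ tail x
apply-dropHead x@(_ ∷ _) = begin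
  map (λ row → dot row x) (tabulate (λ i → e (suc i))) +v 0v ≡⟨ +v-identityʳ _ ⟩
  map (λ row → dot row x) (tabulate (λ i → e (suc i)))       ≡⟨ sym (tabulate-∘ _ _) ⟩
  tabulate (λ i → dot (e (suc i)) x)                         ≡⟨ tabulate-cong (λ i → dot-e (suc i) x) ⟩
  tabulate (lookup (tail x))                                 ≡⟨ tabulate∘lookup (tail x) ⟩
  tail x                                                     ∎
  where open ≡-Reasoning

dropHead-bijection : ∀ {m} (S : Vecℚ (suc m) → Set) (T : Vecℚ m → Set) →
  (∀ x → S x → sumℚ x ≡ 0ℚ) →
  (∀ x → S x → T (tail x)) →
  (∀ y → T y → Σ (Vecℚ (suc m)) λ x → S x × tail x ≡ y) →
  RestrictsToBijection (dropHead m) S T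
dropHead-bijection S T S⇒sum≡0 maps-to onto =
  (λ x Sx → subst T (sym (apply-dropHead x)) (maps-to x Sx)) ,
  (λ x y Sx Sy fx≡fy → tail-injective-on-sum≡0 x y (S⇒sum≡0 x Sx) (S⇒sum≡0 y Sy)
      (trans (sym (apply-dropHead x)) (trans fx≡fy (apply-dropHead y)))) ,
  (λ y Ty → let x , Sx , tx≡y = onto y Ty in x , Sx , trans (apply-dropHead x) tx≡y)

∈Aff⇒sum≡0 : ∀ {N} {x : Vecℚ N} {ps} → All (λ p → sumℚ p ≡ 0ℚ) ps → x ∈Aff ps → sumℚ x ≡ 0ℚ
∈Aff⇒sum≡0 {ps = ps} sums≡0 (c , _ , refl) = sumℚ-lincomb ps c sums≡0

module _ {N} {ps : List (Vecℚ (suc N))} {qs} (rs : ps TailsTo qs) where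

  private
    sr : Pointwise (flip (λ p q → tail p ≡ q)) qs ps
    sr = flip-Pointwise rs

    lift : Vec ℚ (length qs) → Vecℚ (suc N)
    lift d = lincomb ps (relabel sr d)

    tail-lift : ∀ d → tail (lift d) ≡ lincomb qs d
    tail-lift d = trans (tail-lincomb rs _) (cong (lincomb qs) (relabel-inverse rs d))

  tail-∈Conv : ∀ {x} → x ∈Conv ps → tail x ∈Conv qs
  tail-∈Conv (c , c≥0 , Σc≡1 , refl) =
    relabel rs c , relabel-nonneg rs c c≥0 , trans (sumℚ-relabel rs c) Σc≡1 , sym (tail-lincomb rs c)

  tail-∈Aff : ∀ {x} → x ∈Aff ps → tail x ∈Aff qs
  tail-∈Aff (c , Σc≡1 , refl) =
    relabel rs c , trans (sumℚ-relabel rs c) Σc≡1 , sym (tail-lincomb rs c)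

  ∈Conv-lift : ∀ {y} → y ∈Conv qs → Σ (Vecℚ (suc N)) λ x → x ∈Conv ps × tail x ≡ y
  ∈Conv-lift (d , d≥0 , Σd≡1 , refl) = lift d ,
    (relabel sr d , relabel-nonneg sr d d≥0 , trans (sumℚ-relabel sr d) Σd≡1 , refl) , tail-lift d

  ∈Aff-lift : ∀ {y} → y ∈Aff qs → Σ (Vecℚ (suc N)) λ x → x ∈Aff ps × tail x ≡ y
  ∈Aff-lift (d , Σd≡1 , refl) = lift d ,
    (relabel sr d , trans (sumℚ-relabel sr d) Σd≡1 , refl) , tail-lift d

integrallyEquivalent-dropHead : ∀ {m} {ps : List (Vecℚ (suc m))} {qs} →
  All (λ p → sumℚ p ≡ 0ℚ) ps → ps TailsTo qs → IntegrallyEquivalent ps qs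
integrallyEquivalent-dropHead {m} {ps} {qs} sums≡0 rs = dropHead m ,
  dropHead-bijection _ _ (λ _ x∈ → ∈Aff⇒sum≡0 sums≡0 (∈Conv⇒∈Aff x∈))
    (λ _ → tail-∈Conv rs) (λ _ → ∈Conv-lift rs) ,
  dropHead-bijection _ _ (λ _ (_ , x∈) → ∈Aff⇒sum≡0 sums≡0 x∈)
    (λ x (x-int , x∈) → IsLattice-tail x x-int , tail-∈Aff rs x∈)
    (λ y (y-int , y∈) → let x , x∈ , tx≡y = ∈Aff-lift rs y∈ in
      x , (sum≡0⇒IsLattice x (∈Aff⇒sum≡0 sums≡0 x∈) (subst IsLattice (sym tx≡y) y-int) , x∈) , tx≡y)
  where
  ∈Conv⇒∈Aff : ∀ {x} → x ∈Conv ps → x ∈Aff ps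
  ∈Conv⇒∈Aff (c , _ , Σc≡1 , eq) = c , Σc≡1 , eq

sumℚ-u : ∀ {N} (a : Arrow N 0) → sumℚ (u a) ≡ 0ℚ
sumℚ-u (inj₁ i , inj₁ j) = begin
  sumℚ (e j +v (-v e i))     ≡⟨ sumℚ-+v (e j) _ ⟩
  sumℚ (e j) + sumℚ (-v e i) ≡⟨ cong₂ _+_ (sumℚ-e j) (trans (sumℚ-negate (e i)) (cong -_ (sumℚ-e i))) ⟩
  1ℚ + - 1ℚ                  ≡⟨ +-inverseʳ 1ℚ ⟩
  0ℚ                         ∎
  where open ≡-Reasoning
sumℚ-u (inj₁ _ , inj₂ ())
sumℚ-u (inj₂ () , _)

tail-u : ∀ {m} (a : Arrow (suc m) 0) → tail (u a) ≡ u (starV (proj₁ a) , starV (proj₂ a))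
tail-u (inj₁ zero    , inj₁ zero)    = trans (cong (0v +v_) -v-0v) (+v-identityˡ _)
tail-u (inj₁ zero    , inj₁ (suc j)) = trans (cong (e j +v_) -v-0v) (+v-identityʳ _)
tail-u (inj₁ (suc i) , inj₁ zero)    = +v-identityˡ _
tail-u (inj₁ (suc i) , inj₁ (suc j)) = refl
tail-u (inj₁ _ , inj₂ ())
tail-u (inj₂ () , _)

RootPts-TailsTo : ∀ {m} (Q : List (Arrow (suc m) 0)) → RootPts Q TailsTo RootPts (starQ Q)
RootPts-TailsTo []      = []
RootPts-TailsTo (a ∷ Q) = tail-u a ∷ RootPts-TailsTo Q

lemma2p8 : (m : ℕ) (Q : List (Arrow (suc m) 0)) → IsQuiver Q →
    IntegrallyEquivalent (RootPts Q) (RootPts (starQ Q))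
lemma2p8 m Q _ = integrallyEquivalent-dropHead
  (All.map⁺ (All.universal sumℚ-u Q)) (RootPts-TailsTo Q)
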